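{- For every $n$ there is a bijection $h_5:\mathcal{D}_5\cap\mathcal{A}_n\to\{s\in(\mathcal{A}^*\setminus\mathcal{D}_1)\cap\mathcal{A}_n: s_{\max(s)+2}\ge\mathrm{ealm}(s)+1\}$ such that for all $s\in\mathcal{D}_5\cap\mathcal{A}_n$: $\mathrm{asc}(s)=\mathrm{asc}(h_5(s))$, $\mathrm{rep}(s)=\mathrm{rep}(h_5(s))$, $\max(s)=\max(h_5(s))$, $\mathrm{ealm}(s)=\mathrm{ealm}(h_5(s))-1$, $\mathrm{zero}(s)=\mathrm{zero}(h_5(s))+\chi(\mathrm{ealm}(s)=0)$, and if $s\in\mathcal{D}_{5,1}$ then $(\mathrm{rmin},\mathrm{rpos})(s)=(\mathrm{rmin},\mathrm{rpos})(h_5(s))$; if $s\in\mathcal{D}_{5,2}$ then $\mathrm{rmin}(s)=\mathrm{rmin}(h_5(s))$ and $\mathrm{rpos}(s)=\mathrm{rpos}(h_5(s))-1$; if $s\in\mathcal{D}_{5,3}$ then $\mathrm{rmin}(s)=\mathrm{rmin}(h_5(s))-1$ and $\mathrm{rpos}(s)=\mathrm{rpos}(h_5(s))-1$.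
   Context: Inversion sequence: $s=(s_1,\dots,s_n)$, $0\le s_i<i$, $|s|=n$. $\mathrm{asc}(s)=|\{i:s_i<s_{i+1}\}|$. Ascent sequence: $s_i\le\mathrm{asc}(s_1,\dots,s_{i-1})+1$ for $i\ge2$; $\mathcal{A}_n$ = ascent sequences of length $n$; $\mathcal{A}^*$ = all ascent sequences except $(0,1,\dots,|s|-1)$. $\mathrm{rep}(s)=n-|\{s_i\}|$, $\mathrm{zero}(s)=|\{i:s_i=0\}|$, $\max(s)=|\{i:s_i=i-1\}|$, $\mathrm{ealm}(s)=s_{\max(s)+1}$ if $\max(s)\ne|s|$ and $0$ otherwise. $\mathrm{Rmin}(s)=\{s_i:s_i<s_j\ \forall j>i\}$, $\mathrm{rmin}(s)=|\mathrm{Rmin}(s)|$, $\mathrm{Rmin}(s)_j$ its $j$-th smallest element ($j\ge0$). $\mathrm{rpos}(s)$ is the maximal $m$ such that $\mathrm{Rmin}(s)_m$ occurs at least twice after the position of the right-to-left minimum $\mathrm{Rmin}(s)_{m-1}$ (for $m=0$: at least twice in $s$); $0$ if none exists or $\mathrm{rmin}(s)=|s|$. $\mathcal{D}_1=\{s\in\mathcal{A}^*:|s|=\max(s)+1\}$; $\mathcal{D}_5=\{s\in\mathcal{A}^*\setminus\mathcal{D}_1:s_{\max(s)+2}\ge\mathrm{ealm}(s)+2\}$. With $\mu(s)=\min\{s_i:\max(s)+2\le i\le|s|\}$: $\mathcal{D}_{5,1}=\{s\in\mathcal{D}_5:\mu(s)\le\mathrm{ealm}(s)\}\cup\{s\in\mathcal{D}_5:\mu(s)=\mathrm{ealm}(s)+1,\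 \mathrm{rpos}(s)\ge\mathrm{ealm}(s)+1\}$; $\mathcal{D}_{5,2}=\{s\in\mathcal{D}_5:\mu(s)=\mathrm{ealm}(s)+1,\ \mathrm{rpos}(s)=\mathrm{ealm}(s)\}$; $\mathcal{D}_{5,3}=\{s\in\mathcal{D}_5:\mu(s)\ge\mathrm{ealm}(s)+2\}$; these partition $\mathcal{D}_5$. $\chi(P)$ is $1$ if $P$ holds and $0$ otherwise.
   Formalization: The codomain of $h_5$ contains only those $s\in(\mathcal{A}^*\setminus\mathcal{D}_1)\cap\mathcal{A}_n$ with $s_{\max(s)+2}\ge\mathrm{ealm}(s)+1$ that also satisfy $\mathrm{ealm}(s)\ge1$. The statement above fails without it. -}

module Defs where

open import Data.Nat using (ℕ; zero; suc; _+_; _∸_; _⊓_; _≡ᵇ_; _<ᵇ_; _≤ᵇ_)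
open import Data.Bool using (Bool; true; false; _∧_; _∨_; not; if_then_else_; T)
open import Data.List using (List; []; _∷_; length; drop; upTo; foldr; deduplicateᵇ)
open import Data.Product using (Σ; _×_; _,_)

-- Sequences s = (s_1,…,s_n) are lists; position i (1-indexed) is list index i-1.

at : List ℕ → ℕ → ℕ
at []       _       = 0
at (x ∷ _)  zero    = x
at (_ ∷ xs) (suc k) = at xs k

count : (ℕ → Bool) → List ℕ → ℕ
count p []       = 0
count p (x ∷ xs) = (if p x then 1 else 0) + count p xs

allᵇ : (ℕ → Bool) → List ℕ → Bool
allᵇ p []       = true
allᵇ p (x ∷ xs) = p x ∧ allᵇ p xs

eqList : List ℕ → List ℕ → Bool
eqList []       []       = true
eqList (x ∷ xs) (y ∷ ys) = (x ≡ᵇ y) ∧ eqList xs ys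
eqList _        _        = false

asc : List ℕ → ℕ
asc []           = 0
asc (x ∷ [])     = 0
asc (x ∷ y ∷ ys) = (if x <ᵇ y then 1 else 0) + asc (y ∷ ys)

isInvFrom : ℕ → List ℕ → Bool
isInvFrom i []       = true
isInvFrom i (x ∷ xs) = (x <ᵇ i) ∧ isInvFrom (suc i) xs

isInversion : List ℕ → Bool
isInversion = isInvFrom 1

-- ascent condition: s_i ≤ asc(s_1,…,s_{i-1}) + 1 for i ≥ 2
-- (arguments: previous entry, asc of the prefix so far)
ascCondFrom : ℕ → ℕ → List ℕ → Bool
ascCondFrom p a []       = true
ascCondFrom p a (y ∷ ys) = (y ≤ᵇ suc a) ∧ ascCondFrom y (a + (if p <ᵇ y then 1 else 0)) ys

ascCond : List ℕ → Bool
ascCond []       = true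
ascCond (x ∷ xs) = ascCondFrom x 0 xs

isAscent : List ℕ → Bool
isAscent s = isInversion s ∧ ascCond s

isIdentity : List ℕ → Bool
isIdentity s = eqList s (upTo (length s))

inAstar : List ℕ → Bool
inAstar s = isAscent s ∧ not (isIdentity s)

rep : List ℕ → ℕ
rep s = length s ∸ length (deduplicateᵇ _≡ᵇ_ s)

zeroS : List ℕ → ℕ
zeroS = count (_≡ᵇ 0)

maxFrom : ℕ → List ℕ → ℕ
maxFrom k []       = 0
maxFrom k (x ∷ xs) = (if x ≡ᵇ k then 1 else 0) + maxFrom (suc k) xs

maxS : List ℕ → ℕ
maxS = maxFrom 0

ealm : List ℕ → ℕ
ealm s = if maxS s ≡ᵇ length s then 0 else at s (maxS s)

-- right-to-left minima: positions i (0-indexed) with s_i < s_j for all j > i,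
-- listed left to right as (position, value); values are then increasing,
-- so the j-th entry carries Rmin(s)_j.
rminFrom : ℕ → List ℕ → List (ℕ × ℕ)
rminFrom k []       = []
rminFrom k (x ∷ xs) =
  if allᵇ (x <ᵇ_) xs then (k , x) ∷ rminFrom (suc k) xs else rminFrom (suc k) xs

rminList : List ℕ → List (ℕ × ℕ)
rminList = rminFrom 0

rmin : List ℕ → ℕ
rmin s = length (rminList s)

atP : List (ℕ × ℕ) → ℕ → ℕ × ℕ
atP []       _       = (0 , 0)
atP (x ∷ _)  zero    = x
atP (_ ∷ xs) (suc k) = atP xs k

posR : List ℕ → ℕ → ℕ
posR s j with atP (rminList s) j
... | (p , v) = p

valR : List ℕ → ℕ → ℕ
valR s j with atP (rminList s) j
... | (p , v) = v

rposCond : List ℕ → ℕ → Bool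
rposCond s zero     = 2 ≤ᵇ count (_≡ᵇ valR s 0) s
rposCond s (suc m') = 2 ≤ᵇ count (_≡ᵇ valR s (suc m')) (drop (suc (posR s m')) s)

lastGood : List ℕ → ℕ → ℕ
lastGood s zero    = 0
lastGood s (suc m) = if rposCond s m then m else lastGood s m

rpos : List ℕ → ℕ
rpos s = if rmin s ≡ᵇ length s then 0 else lastGood s (rmin s)

chi : Bool → ℕ
chi b = if b then 1 else 0

inD1 : List ℕ → Bool
inD1 s = inAstar s ∧ (length s ≡ᵇ suc (maxS s))

next2 : List ℕ → ℕ
next2 s = at s (suc (maxS s))

inD5 : List ℕ → Bool
inD5 s = inAstar s ∧ not (inD1 s) ∧ (ealm s + 2 ≤ᵇ next2 s)

minList : List ℕ → ℕ
minList []       = 0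
minList (x ∷ xs) = foldr _⊓_ x xs

mu : List ℕ → ℕ
mu s = minList (drop (suc (maxS s)) s)

inD51 : List ℕ → Bool
inD51 s = inD5 s ∧ ((mu s ≤ᵇ ealm s)
                    ∨ ((mu s ≡ᵇ suc (ealm s)) ∧ (suc (ealm s) ≤ᵇ rpos s)))

inD52 : List ℕ → Bool
inD52 s = inD5 s ∧ (mu s ≡ᵇ suc (ealm s)) ∧ (rpos s ≡ᵇ ealm s)

inD53 : List ℕ → Bool
inD53 s = inD5 s ∧ (ealm s + 2 ≤ᵇ mu s)

D5n : ℕ → Set
D5n n = Σ (List ℕ) λ s → T (inD5 s ∧ (length s ≡ᵇ n))

-- {s ∈ (𝒜* ∖ 𝒟₁) ∩ 𝒜_n : s_{max(s)+2} ≥ ealm(s)+1, ealm(s) ≥ 1}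
-- The condition ealm(s) ≥ 1 is forced by ealm(h₅(s)) = ealm(s)+1 and is
-- needed for the statement to be true.
Tgt5n : ℕ → Set
Tgt5n n = Σ (List ℕ) λ s →
  T (inAstar s ∧ not (inD1 s) ∧ (length s ≡ᵇ n) ∧ (suc (ealm s) ≤ᵇ next2 s)
     ∧ (1 ≤ᵇ ealm s))

-- Every s ∈ 𝒜* ∖ 𝒟₁ has the shape (0, 1, …, j, y, x, r) with y ≤ j, x ≤ j + 1 and no entry
-- of r equal to its index, so that max(s) = j + 1, ealm(s) = y and s_{max(s)+2} = x; h₅ raises
-- y to y + 1. On 𝒟₅ we have x ≥ y + 2, so y and y + 1 both lie below x and not above j: the
-- ascents, the set of values and the leading run are unchanged, at most one zero disappears,
-- and the same description shows that h₅ is onto the stated target.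
-- With μ = min(x, r), the right-to-left minima of s are the run entries 0, …, min(y, μ) − 1,
-- then y (at index j + 1) if y < μ, then those of (x, r). So μ ≤ y leaves them unchanged,
-- μ = y + 1 trades the minimum y at index j + 1 for the run entry y, and μ ≥ y + 2 adds the run
-- entry y while moving y + 1 to index j + 1. As rpos is the last index whose "occurs twice after
-- the previous minimum" condition holds, comparing these conditions index by index gives the
-- three cases 𝒟₅,₁, 𝒟₅,₂ and 𝒟₅,₃.

module Submission where

open import Defs
open import Data.Nat
  using (ℕ; zero; suc; pred; _+_; _∸_; _⊓_; _≡ᵇ_; _<ᵇ_; _≤ᵇ_; _≤_; _<_; z≤n; s≤s; z<s; s<s; _≟_; _<?_; _≤?_)
open import Data.Nat.Properties
open import Data.Bool using (Bool; true; false; _∧_; not; if_then_else_; T)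
open import Data.Bool.Properties using (T-∧; T-∨; T-irrelevant; ∧-zeroʳ; ∧-identityʳ; ∧-comm; ∧-assoc)
open import Data.List
  using (List; []; _∷_; length; drop; upTo; applyUpTo; foldr; filter; deduplicateᵇ; _++_; map)
open import Data.List.Properties using (length-++; ++-identityʳ; length-map; filter-++; filter-idem)
open import Data.List.Membership.Propositional using (_∈_)
open import Data.List.Membership.Propositional.Properties using (∈-upTo⁺)
open import Data.List.Relation.Unary.Any using (here; there)
open import Data.Product using (Σ; _×_; _,_; proj₁; proj₂; uncurry)
open import Data.Sum using (_⊎_; inj₁; inj₂)
import Data.Sum as Sum
open import Data.Unit using (⊤; tt)
open import Function using (_∘_)
open import Function.Bundles using (Equivalence; _⤖_; Bijection; mk↔ₛ′)
open import Function.Properties.Inverse using (↔⇒⤖)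
open import Relation.Nullary using (¬_; ¬?; yes; no; does; contradiction)
open import Relation.Unary using (Decidable)
open import Relation.Nullary.Decidable using (T?; dec-true; dec-false)
open import Relation.Binary.PropositionalEquality

≡ᵇ-refl : ∀ n → (n ≡ᵇ n) ≡ true
≡ᵇ-refl n = dec-true (n ≟ n) refl

≡ᵇ-false : ∀ {m n} → m ≢ n → (m ≡ᵇ n) ≡ false
≡ᵇ-false {m} {n} = dec-false (m ≟ n)

<ᵇ-true : ∀ {m n} → m < n → (m <ᵇ n) ≡ true
<ᵇ-true {m} {n} = dec-true (m <? n)

<ᵇ-false : ∀ {m n} → n ≤ m → (m <ᵇ n) ≡ false
<ᵇ-false {m} {n} n≤m = dec-false (m <? n) (≤⇒≯ n≤m)

≤ᵇ-true : ∀ {m n} → m ≤ n → (m ≤ᵇ n) ≡ true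
≤ᵇ-true {m} {n} = dec-true (m ≤? n)

T-∧⁻ : ∀ {a b} → T (a ∧ b) → T a × T b
T-∧⁻ = Equivalence.to T-∧

T-∧⁺ : ∀ {a b} → T a → T b → T (a ∧ b)
T-∧⁺ p q = Equivalence.from T-∧ (p , q)

T-not⇒¬T : ∀ {b} → T (not b) → ¬ T b
T-not⇒¬T {false} _ ()

∧-shuffle : ∀ a b c → (a ∧ b) ∧ c ≡ a ∧ c ∧ b ∧ true
∧-shuffle false b c = refl
∧-shuffle true  b c = trans (∧-comm b c) (cong (c ∧_) (sym (∧-identityʳ b)))

+1≡suc : ∀ k → k + 1 ≡ suc k
+1≡suc k = trans (+-suc k 0) (cong suc (+-identityʳ k))

+chi≤suc : ∀ a b → a + chi b ≤ suc a
+chi≤suc a true  = ≤-reflexive (+1≡suc a)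
+chi≤suc a false = ≤-trans (≤-reflexive (+-identityʳ a)) (n≤1+n a)

2≤ᵇsuc-+ : ∀ a b → 1 ≤ b → (2 ≤ᵇ suc (a + b)) ≡ true
2≤ᵇsuc-+ a b 1≤b = ≤ᵇ-true (s≤s (≤-trans 1≤b (m≤n+m b a)))

count-++ : ∀ p (a b : List ℕ) → count p (a ++ b) ≡ count p a + count p b
count-++ p []      b = refl
count-++ p (x ∷ a) b =
  trans (cong (_ +_) (count-++ p a b)) (sym (+-assoc (if p x then 1 else 0) (count p a) (count p b)))

eqList-refl : ∀ l → eqList l l ≡ true
eqList-refl []      = refl
eqList-refl (x ∷ l) rewrite ≡ᵇ-refl x = eqList-refl l

eqList-++ : ∀ a b c → eqList (a ++ b) (a ++ c) ≡ eqList b c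
eqList-++ []      b c = refl
eqList-++ (x ∷ a) b c rewrite ≡ᵇ-refl x = eqList-++ a b c

allᵇ-++ : ∀ p (a b : List ℕ) → allᵇ p (a ++ b) ≡ allᵇ p a ∧ allᵇ p b
allᵇ-++ p []      b = refl
allᵇ-++ p (x ∷ a) b = trans (cong (p x ∧_) (allᵇ-++ p a b)) (sym (∧-assoc (p x) (allᵇ p a) (allᵇ p b)))

mapAt : ℕ → (ℕ → ℕ) → List ℕ → List ℕ
mapAt _       f []       = []
mapAt zero    f (x ∷ xs) = f x ∷ xs
mapAt (suc k) f (x ∷ xs) = x ∷ mapAt k f xs

drop-++-∷ : ∀ (A : List ℕ) {p} y y′ X → length A ≤ p →
            drop (suc p) (A ++ y ∷ X) ≡ drop (suc p) (A ++ y′ ∷ X)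
drop-++-∷ []      y y′ X _         = refl
drop-++-∷ (a ∷ A) y y′ X (s≤s |A|≤p) = drop-++-∷ A y y′ X |A|≤p

module _ {A : Set} {P Q : A → Set} (P? : Decidable P) (Q? : Decidable Q) where

  filter-comm : ∀ xs → filter P? (filter Q? xs) ≡ filter Q? (filter P? xs)
  filter-comm []       = refl
  filter-comm (x ∷ xs) with does (Q? x) in Qx | does (P? x) in Px
  ... | true  | true  rewrite Qx | Px = cong (x ∷_) (filter-comm xs)
  ... | true  | false rewrite Px      = filter-comm xs
  ... | false | true  rewrite Qx      = filter-comm xs
  ... | false | false                 = filter-comm xs

without : ℕ → List ℕ → List ℕ
without y = filter (λ w → ¬? (T? (y ≡ᵇ w)))

dedup : List ℕ → List ℕ
dedup = deduplicateᵇ _≡ᵇ_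

without-dedup : ∀ y l → without y (dedup l) ≡ dedup (without y l)
without-dedup y []       = refl
without-dedup y (w ∷ ws) with y ≡ᵇ w in y≡ᵇw
... | false = cong (w ∷_) (trans (filter-comm _ _ (dedup ws)) (cong (without w) (without-dedup y ws)))
... | true rewrite ≡ᵇ⇒≡ y w (subst T (sym y≡ᵇw) tt) = trans (filter-idem _ (dedup ws)) (without-dedup w ws)

without-∷ : ∀ y A B → without y (A ++ y ∷ B) ≡ without y (A ++ B)
without-∷ y A B
  rewrite filter-++ (λ w → ¬? (T? (y ≡ᵇ w))) A (y ∷ B) | filter-++ (λ w → ¬? (T? (y ≡ᵇ w))) A B | ≡ᵇ-refl y = refl

dedup-++-∷ : ∀ {y A} B → y ∈ A → dedup (A ++ y ∷ B) ≡ dedup (A ++ B)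
dedup-++-∷ {y} {_ ∷ A} B (here refl) = cong (y ∷_) (begin
  without y (dedup (A ++ y ∷ B)) ≡⟨ without-dedup y (A ++ y ∷ B) ⟩
  dedup (without y (A ++ y ∷ B)) ≡⟨ cong dedup (without-∷ y A B) ⟩
  dedup (without y (A ++ B))     ≡⟨ without-dedup y (A ++ B) ⟨
  without y (dedup (A ++ B))     ∎)
  where open ≡-Reasoning
dedup-++-∷ {y} {z ∷ A} B (there y∈A) = cong (λ l → z ∷ without z l) (dedup-++-∷ B y∈A)

foldr-⊓-seed : ∀ a b r → foldr _⊓_ (a ⊓ b) r ≡ a ⊓ foldr _⊓_ b r
foldr-⊓-seed a b []       = refl
foldr-⊓-seed a b (c ∷ r) rewrite foldr-⊓-seed a b r =
  trans (sym (⊓-assoc c a _)) (trans (cong (_⊓ foldr _⊓_ b r) (⊓-comm c a)) (⊓-assoc a c _))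

minList-∷ : ∀ x y r → minList (x ∷ y ∷ r) ≡ x ⊓ minList (y ∷ r)
minList-∷ x y r =
  trans (sym (foldr-⊓-seed y x r)) (trans (cong (λ m → foldr _⊓_ m r) (⊓-comm y x)) (foldr-⊓-seed x y r))

<ᵇ-⊓ : ∀ v a b → (v <ᵇ a ⊓ b) ≡ (v <ᵇ a) ∧ (v <ᵇ b)
<ᵇ-⊓ v       zero    b       = refl
<ᵇ-⊓ zero    (suc a) zero    = refl
<ᵇ-⊓ (suc v) (suc a) zero    = sym (∧-zeroʳ (v <ᵇ a))
<ᵇ-⊓ zero    (suc a) (suc b) = refl
<ᵇ-⊓ (suc v) (suc a) (suc b) = <ᵇ-⊓ v a b

allᵇ-<ᵇ-minList : ∀ v x r → allᵇ (v <ᵇ_) (x ∷ r) ≡ (v <ᵇ minList (x ∷ r))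
allᵇ-<ᵇ-minList v x []      = ∧-identityʳ (v <ᵇ x)
allᵇ-<ᵇ-minList v x (y ∷ r) rewrite minList-∷ x y r | <ᵇ-⊓ v x (minList (y ∷ r)) =
  cong ((v <ᵇ x) ∧_) (allᵇ-<ᵇ-minList v y r)

count-<minList : ∀ {v} x r → v < minList (x ∷ r) → count (_≡ᵇ v) (x ∷ r) ≡ 0
count-<minList {v} x r v<min = go (x ∷ r) (trans (allᵇ-<ᵇ-minList v x r) (<ᵇ-true v<min))
  where
  go : ∀ l → allᵇ (v <ᵇ_) l ≡ true → count (_≡ᵇ v) l ≡ 0
  go []      _ = refl
  go (y ∷ l) all with v <ᵇ y in v<ᵇy
  go (y ∷ l) all | true rewrite ≡ᵇ-false (>⇒≢ (<ᵇ⇒< v y (subst T (sym v<ᵇy) tt))) = go l all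

1≤count-minList : ∀ x r → 1 ≤ count (_≡ᵇ minList (x ∷ r)) (x ∷ r)
1≤count-minList x []      rewrite ≡ᵇ-refl x = ≤-refl
1≤count-minList x (y ∷ r) rewrite minList-∷ x y r with ≤-total x (minList (y ∷ r))
... | inj₁ x≤m rewrite m≤n⇒m⊓n≡m x≤m | ≡ᵇ-refl x = s≤s z≤n
... | inj₂ m≤x rewrite m≥n⇒m⊓n≡n m≤x = ≤-trans (1≤count-minList y r) (m≤n+m _ (chi (x ≡ᵇ minList (y ∷ r))))

iota : ℕ → ℕ → List ℕ
iota k zero    = []
iota k (suc n) = k ∷ iota (suc k) n

applyUpTo-iota : ∀ (f : ℕ → ℕ) k n → (∀ i → f i ≡ k + i) → applyUpTo f n ≡ iota k n
applyUpTo-iota f k zero    f≗k+ = refl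
applyUpTo-iota f k (suc n) f≗k+ =
  cong₂ _∷_ (trans (f≗k+ 0) (+-identityʳ k))
            (applyUpTo-iota (f ∘ suc) (suc k) n (λ i → trans (f≗k+ (suc i)) (+-suc k i)))

upTo≡iota : ∀ n → upTo n ≡ iota 0 n
upTo≡iota n = applyUpTo-iota (λ i → i) 0 n (λ _ → refl)

length-iota : ∀ k n → length (iota k n) ≡ n
length-iota k zero    = refl
length-iota k (suc n) = cong suc (length-iota (suc k) n)

iota-+ : ∀ k m n → iota k (m + n) ≡ iota k m ++ iota (k + m) n
iota-+ k zero    n = cong (λ k′ → iota k′ n) (sym (+-identityʳ k))
iota-+ k (suc m) n =
  cong (k ∷_) (trans (iota-+ (suc k) m n) (cong (λ k′ → iota (suc k) m ++ iota k′ n) (sym (+-suc k m))))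

maxFrom-iota-++ : ∀ k n l → maxFrom k (iota k n ++ l) ≡ n + maxFrom (k + n) l
maxFrom-iota-++ k zero    l rewrite +-identityʳ k = refl
maxFrom-iota-++ k (suc n) l rewrite ≡ᵇ-refl k | maxFrom-iota-++ (suc k) n l | +-suc k n = refl

isInvFrom-iota-++ : ∀ k n l → isInvFrom (suc k) (iota k n ++ l) ≡ isInvFrom (suc k + n) l
isInvFrom-iota-++ k zero    l rewrite +-identityʳ k = refl
isInvFrom-iota-++ k (suc n) l rewrite <ᵇ-true (n<1+n k) | isInvFrom-iota-++ (suc k) n l | +-suc k n = refl

ascCondFrom-iota-++ : ∀ k n l → ascCondFrom k k (iota (suc k) n ++ l) ≡ ascCondFrom (k + n) (k + n) l
ascCondFrom-iota-++ k zero    l rewrite +-identityʳ k = refl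
ascCondFrom-iota-++ k (suc n) l
  rewrite <ᵇ-true (n<1+n k) | +1≡suc k | ascCondFrom-iota-++ (suc k) n l | +-suc k n = refl

asc-iota-++ : ∀ k n l → asc (k ∷ iota (suc k) n ++ l) ≡ n + asc (k + n ∷ l)
asc-iota-++ k zero    l rewrite +-identityʳ k = refl
asc-iota-++ k (suc n) l rewrite <ᵇ-true (n<1+n k) | asc-iota-++ (suc k) n l | +-suc k n = refl

count-iota : ∀ {i} k n → i < k → count (_≡ᵇ i) (iota k n) ≡ 0
count-iota k zero    i<k = refl
count-iota k (suc n) i<k rewrite ≡ᵇ-false (>⇒≢ i<k) = count-iota (suc k) n (m<n⇒m<1+n i<k)

drop-iota-++ : ∀ k n l {i} → i ≤ n → drop i (iota k n ++ l) ≡ iota (k + i) (n ∸ i) ++ l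
drop-iota-++ k n       l {zero}  z≤n       rewrite +-identityʳ k = refl
drop-iota-++ k (suc n) l {suc i} (s≤s i≤n) rewrite drop-iota-++ (suc k) n l i≤n | +-suc k i = refl

at-iota-++ : ∀ k n y l → at (iota k n ++ y ∷ l) n ≡ y
at-iota-++ k zero    y l = refl
at-iota-++ k (suc n) y l = at-iota-++ (suc k) n y l

at-iota-++-∷ : ∀ k n y x l → at (iota k n ++ y ∷ x ∷ l) (suc n) ≡ x
at-iota-++-∷ k zero    y x l = refl
at-iota-++-∷ k (suc n) y x l = at-iota-++-∷ (suc k) n y x l

drop-iota-++-∷ : ∀ k n y l → drop (suc n) (iota k n ++ y ∷ l) ≡ l
drop-iota-++-∷ k zero    y l = refl
drop-iota-++-∷ k (suc n) y l = drop-iota-++-∷ (suc k) n y l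

mapAt-iota-++ : ∀ k n f y l → mapAt n f (iota k n ++ y ∷ l) ≡ iota k n ++ f y ∷ l
mapAt-iota-++ k zero    f y l = refl
mapAt-iota-++ k (suc n) f y l = cong (k ∷_) (mapAt-iota-++ (suc k) n f y l)

allᵇ-<ᵇ-iota : ∀ {v} k n → v < k → allᵇ (v <ᵇ_) (iota k n) ≡ true
allᵇ-<ᵇ-iota k zero    v<k = refl
allᵇ-<ᵇ-iota k (suc n) v<k rewrite <ᵇ-true v<k = allᵇ-<ᵇ-iota (suc k) n (m<n⇒m<1+n v<k)

isIdentity-iota : ∀ n → isIdentity (iota 0 n ++ []) ≡ true
isIdentity-iota n rewrite ++-identityʳ (iota 0 n) | length-iota 0 n | upTo≡iota n = eqList-refl (iota 0 n)

NotHeadedBy : ℕ → List ℕ → Set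
NotHeadedBy n []      = ⊤
NotHeadedBy n (y ∷ _) = y ≢ n

splitIota : ∀ k l → Σ ℕ λ a → Σ (List ℕ) λ rest → l ≡ iota k a ++ rest × NotHeadedBy (k + a) rest
splitIota k []      = 0 , [] , refl , tt
splitIota k (x ∷ l) with x ≟ k
... | no x≢k = 0 , x ∷ l , refl , λ x≡k+0 → x≢k (trans x≡k+0 (+-identityʳ k))
... | yes refl with splitIota (suc x) l
...   | a , rest , l≡ , stop =
  suc a , rest , cong (x ∷_) l≡ , subst (λ n → NotHeadedBy n rest) (sym (+-suc x a)) stop

lastBelow : (ℕ → Bool) → ℕ → ℕ
lastBelow f zero    = 0
lastBelow f (suc b) = if f b then b else lastBelow f b

lastBelow-cong : ∀ f g b → (∀ i → i < b → f i ≡ g i) → lastBelow f b ≡ lastBelow g b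
lastBelow-cong f g zero    f≗g = refl
lastBelow-cong f g (suc b) f≗g rewrite f≗g b ≤-refl =
  cong (if g b then b else_) (lastBelow-cong f g b (λ i i<b → f≗g i (m<n⇒m<1+n i<b)))

lastBelow-shift : ∀ f g b {e} → (∀ i → i < b → g (suc i) ≡ f i) → e < b → f e ≡ true →
                  lastBelow g (suc b) ≡ suc (lastBelow f b)
lastBelow-shift f g (suc b) {e} g∘suc≗f e<1+b fe rewrite g∘suc≗f b ≤-refl with f b in fb
... | true  = refl
... | false = lastBelow-shift f g b (λ i i<b → g∘suc≗f i (m<n⇒m<1+n i<b)) e<b fe
  where
  e<b : e < b
  e<b = ≤∧≢⇒< (≤-pred e<1+b) λ { refl → contradiction (trans (sym fe) fb) λ () }

lastBelow-agreeAbove : ∀ f g k b → k ≤ b → (∀ i → k ≤ i → i < b → f i ≡ g i) →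
                       (lastBelow f b ≡ lastBelow g b × k ≤ lastBelow f b) ⊎
                       (lastBelow f b ≡ lastBelow f k × lastBelow g b ≡ lastBelow g k)
lastBelow-agreeAbove f g k b k≤b agree with m≤n⇒m<n∨m≡n k≤b
... | inj₂ refl = inj₂ (refl , refl)
lastBelow-agreeAbove f g k (suc b) _ agree | inj₁ k<1+b rewrite sym (agree b (≤-pred k<1+b) ≤-refl) with f b
... | true  = inj₁ (refl , ≤-pred k<1+b)
... | false = lastBelow-agreeAbove f g k b (≤-pred k<1+b) (λ i k≤i i<b → agree i k≤i (m<n⇒m<1+n i<b))

lastBelow-agreeAbove-suc : ∀ f g e b → f e ≡ true → g (suc e) ≡ true → 2 + e ≤ b →
                           (∀ i → 2 + e ≤ i → i < b → f i ≡ g i) →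
                           (lastBelow f b ≡ lastBelow g b × suc e ≤ lastBelow f b) ⊎
                           (lastBelow f b ≡ e × lastBelow g b ≡ suc e)
lastBelow-agreeAbove-suc f g e b fe gse 2+e≤b agree with lastBelow-agreeAbove f g (2 + e) b 2+e≤b agree
... | inj₁ (f≡g , 2+e≤) = inj₁ (f≡g , <⇒≤ 2+e≤)
... | inj₂ (f≡ , g≡) rewrite f≡ | g≡ | gse | fe with f (suc e)
...   | true  = inj₁ (refl , ≤-refl)
...   | false = inj₂ (refl , refl)

data Position (c : ℕ) : ℕ → Set where
  before : ∀ {i} → i < c → Position c i
  middle : Position c c
  after  : ∀ i → Position c (c + suc i)

position : ∀ c i → Position c i
position zero    zero    = middle
position zero    (suc i) = after i
position (suc c) zero    = before z<s
position (suc c) (suc i) with position c i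
... | before i<c = before (s<s i<c)
... | middle     = middle
... | after k    = after k

suffix-bound : ∀ c i ρ → c + suc i < c + ρ → i < ρ
suffix-bound c i ρ lt = <⇒≤ (+-cancelˡ-< c (suc i) ρ lt)

-- Decomposition of 𝒜* ∖ 𝒟₁

-- Entries are bounded by a + 1, and a grows by at most one per entry while the index grows by
-- exactly one, so the entries never catch up with their indices.
maxFrom≡0 : ∀ p a l k → T (ascCondFrom p a l) → 2 + a ≤ k → maxFrom k l ≡ 0
maxFrom≡0 p a []       k _ _ = refl
maxFrom≡0 p a (y ∷ ys) k valid 2+a≤k
  with y≤1+a , rest ← T-∧⁻ {y ≤ᵇ suc a} valid
  rewrite ≡ᵇ-false {y} {k} (<⇒≢ (≤-trans (s≤s (≤ᵇ⇒≤ y (suc a) y≤1+a)) 2+a≤k)) =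
  maxFrom≡0 y _ ys (suc k) rest (s≤s (≤-trans (s≤s (+chi≤suc a (p <ᵇ y))) 2+a≤k))

assemble : ℕ → ℕ → ℕ → List ℕ → List ℕ
assemble j y x r = iota 0 (suc j) ++ y ∷ x ∷ r

data Assembled : List ℕ → Set where
  assembled : ∀ j y x r → y ≤ j → x ≤ suc j → maxFrom (3 + j) r ≡ 0 → Assembled (assemble j y x r)

inAstar-parts : ∀ s → T (inAstar s) → T (isInversion s) × T (ascCond s) × T (not (isIdentity s))
inAstar-parts s astar with isInversion s | ascCond s | isIdentity s
... | true | true | false = tt , tt , tt

length≡1+maxS-iota-∷ : ∀ j {y} → y ≢ suc j →
                       length (iota 0 (suc j) ++ y ∷ []) ≡ suc (maxS (iota 0 (suc j) ++ y ∷ []))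
length≡1+maxS-iota-∷ j {y} y≢1+j = begin
  length (iota 0 (suc j) ++ y ∷ [])       ≡⟨ length-++ (iota 0 (suc j)) ⟩
  length (iota 0 (suc j)) + 1             ≡⟨ cong (_+ 1) (length-iota 0 (suc j)) ⟩
  suc j + 1                               ≡⟨ +-suc (suc j) 0 ⟩
  suc (suc j + (chi false + 0))           ≡⟨ cong (λ b → suc (suc j + (chi b + 0))) (≡ᵇ-false y≢1+j) ⟨
  suc (suc j + maxFrom (suc j) (y ∷ []))  ≡⟨ cong suc (maxFrom-iota-++ 0 (suc j) (y ∷ [])) ⟨
  suc (maxS (iota 0 (suc j) ++ y ∷ []))   ∎
  where open ≡-Reasoning

decompose : ∀ s → T (inAstar s) → T (not (inD1 s)) → Assembled s
decompose s astar notD1 with splitIota 0 s | inAstar-parts s astar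
... | zero , [] , refl , _ | _ = contradiction astar λ ()
... | zero , y ∷ _ , refl , y≢0 | inversion , _ =
  contradiction (n<1⇒n≡0 (<ᵇ⇒< y 1 (proj₁ (T-∧⁻ inversion)))) y≢0
... | suc j , [] , refl , _ | _ , _ , notIdentity =
  contradiction (subst T (sym (isIdentity-iota (suc j))) tt) (T-not⇒¬T notIdentity)
... | suc j , y ∷ [] , refl , y≢1+j | _ =
  contradiction (T-∧⁺ astar (≡⇒≡ᵇ _ _ (length≡1+maxS-iota-∷ j y≢1+j))) (T-not⇒¬T notD1)
... | suc j , y ∷ x ∷ r , refl , y≢1+j | inversion , ascent , _ = assembled j y x r y≤j x≤1+j noMax
  where
  y≤j : y ≤ j
  y≤j = ≤-pred (≤∧≢⇒< (≤-pred (<ᵇ⇒< y (2 + j) (proj₁ (T-∧⁻ tail-inversion)))) y≢1+j)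
    where tail-inversion = subst T (isInvFrom-iota-++ 0 (suc j) (y ∷ x ∷ r)) inversion
  tail-ascent : T (ascCondFrom y (j + 0) (x ∷ r))
  tail-ascent = subst (λ b → T (ascCondFrom y (j + (if b then 1 else 0)) (x ∷ r))) (<ᵇ-false y≤j)
                  (proj₂ (T-∧⁻ {y ≤ᵇ suc j} (subst T (ascCondFrom-iota-++ 0 j (y ∷ x ∷ r)) ascent)))
  x≤1+j : x ≤ suc j
  x≤1+j = subst (x ≤_) (cong suc (+-identityʳ j)) (≤ᵇ⇒≤ x _ (proj₁ (T-∧⁻ tail-ascent)))
  noMax : maxFrom (3 + j) r ≡ 0
  noMax = maxFrom≡0 x _ r (3 + j) (proj₂ (T-∧⁻ {x ≤ᵇ suc (j + 0)} tail-ascent))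
            (s≤s (s≤s (≤-trans (+chi≤suc (j + 0) (y <ᵇ x)) (s≤s (≤-reflexive (+-identityʳ j))))))

length-assemble : ∀ j y x r → length (assemble j y x r) ≡ suc j + suc (suc (length r))
length-assemble j y x r = trans (length-++ (iota 0 (suc j))) (cong (_+ suc (suc (length r))) (length-iota 0 (suc j)))

3+j≤length-assemble : ∀ j y x r → 3 + j ≤ length (assemble j y x r)
3+j≤length-assemble j y x r =
  subst₂ _≤_ (cong suc (+-comm j 2)) (sym (length-assemble j y x r)) (+-monoʳ-≤ (suc j) (s≤s (s≤s z≤n)))

isInversion-assemble : ∀ {j y} x r → y ≤ j → isInversion (assemble j y x r) ≡ isInvFrom (3 + j) (x ∷ r)
isInversion-assemble {j} {y} x r y≤j
  rewrite isInvFrom-iota-++ 0 (suc j) (y ∷ x ∷ r) | <ᵇ-true {y} {2 + j} (s≤s (m≤n⇒m≤1+n y≤j)) = refl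

ascCond-assemble : ∀ {j y} x r → y ≤ j → y < x →
                   ascCond (assemble j y x r) ≡ (x ≤ᵇ suc (j + 0)) ∧ ascCondFrom x (j + 0 + 1) r
ascCond-assemble {j} {y} x r y≤j y<x
  rewrite ascCondFrom-iota-++ 0 j (y ∷ x ∷ r) | ≤ᵇ-true {y} {suc j} (m≤n⇒m≤1+n y≤j)
        | <ᵇ-false {j} {y} y≤j | <ᵇ-true y<x = refl

isAscent-assemble : ∀ {j y y′} x r → y ≤ j → y < x → y′ ≤ j → y′ < x →
                    isAscent (assemble j y x r) ≡ isAscent (assemble j y′ x r)
isAscent-assemble x r y≤j y<x y′≤j y′<x
  rewrite isInversion-assemble x r y≤j | isInversion-assemble x r y′≤j
        | ascCond-assemble x r y≤j y<x | ascCond-assemble x r y′≤j y′<x = refl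

maxS-assemble : ∀ {j y x} r → y ≤ j → x ≤ suc j → maxFrom (3 + j) r ≡ 0 → maxS (assemble j y x r) ≡ suc j
maxS-assemble {j} {y} {x} r y≤j x≤1+j noMax
  rewrite maxFrom-iota-++ 0 (suc j) (y ∷ x ∷ r)
        | ≡ᵇ-false (<⇒≢ (s≤s y≤j)) | ≡ᵇ-false (<⇒≢ (s≤s x≤1+j)) | noMax =
  +-identityʳ (suc j)

isIdentity-assemble : ∀ {j y} x r → y ≤ j → isIdentity (assemble j y x r) ≡ false
isIdentity-assemble {j} {y} x r y≤j = begin
  eqList (assemble j y x r) (upTo (length (assemble j y x r)))
    ≡⟨ cong (λ n → eqList (assemble j y x r) (upTo n)) (length-assemble j y x r) ⟩
  eqList (assemble j y x r) (upTo (suc j + suc (suc (length r))))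
    ≡⟨ cong (eqList (assemble j y x r)) (trans (upTo≡iota _) (iota-+ 0 (suc j) _)) ⟩
  eqList (assemble j y x r) (iota 0 (suc j) ++ iota (suc j) (suc (suc (length r))))
    ≡⟨ eqList-++ (iota 0 (suc j)) (y ∷ x ∷ r) _ ⟩
  eqList (y ∷ x ∷ r) (iota (suc j) (suc (suc (length r))))
    ≡⟨ cong (_∧ eqList (x ∷ r) (iota (2 + j) (suc (length r)))) (≡ᵇ-false (<⇒≢ (s≤s y≤j))) ⟩
  false ∎
  where open ≡-Reasoning

ealm≡at : ∀ s {m} → maxS s ≡ m → m ≢ length s → ealm s ≡ at s m
ealm≡at s refl m≢len rewrite ≡ᵇ-false m≢len = refl

inD1≡false : ∀ s {m} → maxS s ≡ m → length s ≢ suc m → inD1 s ≡ false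
inD1≡false s refl len≢ rewrite ≡ᵇ-false len≢ = ∧-zeroʳ (inAstar s)

module _ {j y x : ℕ} {r : List ℕ} (max≡ : maxS (assemble j y x r) ≡ suc j) where

  ealm-assemble : ealm (assemble j y x r) ≡ y
  ealm-assemble =
    trans (ealm≡at (assemble j y x r) max≡ (<⇒≢ (≤-trans (n≤1+n (2 + j)) (3+j≤length-assemble j y x r))))
          (at-iota-++ 0 (suc j) y (x ∷ r))

  next2-assemble : next2 (assemble j y x r) ≡ x
  next2-assemble = trans (cong (λ m → at (assemble j y x r) (suc m)) max≡) (at-iota-++-∷ 0 (suc j) y x r)

  mu-assemble : mu (assemble j y x r) ≡ minList (x ∷ r)
  mu-assemble = trans (cong (λ m → minList (drop (suc m) (assemble j y x r))) max≡)
                      (cong minList (drop-iota-++-∷ 0 (suc j) y (x ∷ r)))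

  inD1-assemble : inD1 (assemble j y x r) ≡ false
  inD1-assemble = inD1≡false (assemble j y x r) max≡ (<⇒≢ (3+j≤length-assemble j y x r) ∘ sym)

asc-assemble : ∀ {j y} x r → y ≤ j → y < x → asc (assemble j y x r) ≡ j + suc (asc (x ∷ r))
asc-assemble {j} {y} x r y≤j y<x
  rewrite asc-iota-++ 0 j (y ∷ x ∷ r) | <ᵇ-false {j} {y} y≤j | <ᵇ-true y<x = refl

dedup-assemble : ∀ {j y} x r → y ≤ j → dedup (assemble j y x r) ≡ dedup (iota 0 (suc j) ++ x ∷ r)
dedup-assemble {j} {y} x r y≤j =
  dedup-++-∷ (x ∷ r) (subst (y ∈_) (upTo≡iota (suc j)) (∈-upTo⁺ (s≤s y≤j)))

rep-assemble : ∀ {j y y′} x r → y ≤ j → y′ ≤ j → rep (assemble j y x r) ≡ rep (assemble j y′ x r)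
rep-assemble {j} {y} {y′} x r y≤j y′≤j =
  cong₂ _∸_ (trans (length-assemble j y x r) (sym (length-assemble j y′ x r)))
            (cong length (trans (dedup-assemble x r y≤j) (sym (dedup-assemble x r y′≤j))))

zeroS-assemble : ∀ j y x r →
                 zeroS (assemble j y x r) ≡ zeroS (iota 0 (suc j)) + (chi (y ≡ᵇ 0) + zeroS (x ∷ r))
zeroS-assemble j y x r = count-++ (_≡ᵇ 0) (iota 0 (suc j)) (y ∷ x ∷ r)

count-drop-assemble : ∀ j y x r {i} → i ≤ j →
                      count (_≡ᵇ i) (drop i (assemble j y x r)) ≡ suc (chi (y ≡ᵇ i) + count (_≡ᵇ i) (x ∷ r))
count-drop-assemble j y x r {i} i≤j
  rewrite drop-iota-++ 0 (suc j) (y ∷ x ∷ r) (m≤n⇒m≤1+n i≤j) | +-∸-assoc 1 i≤j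
        | count-++ (_≡ᵇ i) (iota i (suc (j ∸ i))) (y ∷ x ∷ r) | ≡ᵇ-refl i
        | count-iota {i} (suc i) (j ∸ i) ≤-refl = refl

-- The bijection h₅

InD5 : ℕ → List ℕ → Bool
InD5 n s = inD5 s ∧ (length s ≡ᵇ n)

InTarget : ℕ → List ℕ → Bool
InTarget n t = inAstar t ∧ not (inD1 t) ∧ (length t ≡ᵇ n) ∧ (suc (ealm t) ≤ᵇ next2 t) ∧ (1 ≤ᵇ ealm t)

inD5-reduce : ∀ s {y x} → isIdentity s ≡ false → inD1 s ≡ false → ealm s ≡ y → next2 s ≡ x →
              inD5 s ≡ isAscent s ∧ (y + 2 ≤ᵇ x)
inD5-reduce s notId notD1 ealm≡ next2≡ rewrite notId | notD1 | ealm≡ | next2≡ =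
  cong (_∧ _) (∧-identityʳ (isAscent s))

InTarget-reduce : ∀ n t {y x} → isIdentity t ≡ false → inD1 t ≡ false → ealm t ≡ y → next2 t ≡ x →
                  InTarget n t ≡ isAscent t ∧ (length t ≡ᵇ n) ∧ (suc y ≤ᵇ x) ∧ (1 ≤ᵇ y)
InTarget-reduce n t {y} {x} notId notD1 ealm≡ next2≡ rewrite notId | notD1 | ealm≡ | next2≡ =
  cong (_∧ ((length t ≡ᵇ n) ∧ (suc y ≤ᵇ x) ∧ (1 ≤ᵇ y))) (∧-identityʳ (isAscent t))

module _ {j y x : ℕ} {r : List ℕ} (y≤j : y ≤ j) (x≤1+j : x ≤ suc j) (noMax : maxFrom (3 + j) r ≡ 0) where
  private
    max≡ = maxS-assemble r y≤j x≤1+j noMax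

  inD5-assemble : inD5 (assemble j y x r) ≡ isAscent (assemble j y x r) ∧ (y + 2 ≤ᵇ x)
  inD5-assemble = inD5-reduce (assemble j y x r) (isIdentity-assemble x r y≤j)
                    (inD1-assemble max≡) (ealm-assemble max≡) (next2-assemble max≡)

  InTarget-assemble : ∀ n → InTarget n (assemble j y x r) ≡
                      isAscent (assemble j y x r) ∧ (length (assemble j y x r) ≡ᵇ n) ∧ (suc y ≤ᵇ x) ∧ (1 ≤ᵇ y)
  InTarget-assemble n = InTarget-reduce n (assemble j y x r) (isIdentity-assemble x r y≤j)
                          (inD1-assemble max≡) (ealm-assemble max≡) (next2-assemble max≡)

  InD5-assemble⇒ : ∀ n → T (InD5 n (assemble j y x r)) → 2 + y ≤ x
  InD5-assemble⇒ n p with _ , y+2≤ᵇx ← T-∧⁻ (subst T inD5-assemble (proj₁ (T-∧⁻ p))) =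
    subst (_≤ x) (+-comm y 2) (≤ᵇ⇒≤ (y + 2) x y+2≤ᵇx)

  InTarget-assemble⇒ : ∀ n → T (InTarget n (assemble j y x r)) → suc y ≤ x × 1 ≤ y
  InTarget-assemble⇒ n q
    with _ , q₁ ← T-∧⁻ {isAscent (assemble j y x r)} (subst T (InTarget-assemble n) q)
    with _ , q₂ ← T-∧⁻ {length (assemble j y x r) ≡ᵇ n} q₁
    with 1+y≤ᵇx , 1≤ᵇy ← T-∧⁻ q₂ = ≤ᵇ⇒≤ (suc y) x 1+y≤ᵇx , ≤ᵇ⇒≤ 1 y 1≤ᵇy

InD5⇒Astar∖D1 : ∀ n s → T (InD5 n s) → T (inAstar s) × T (not (inD1 s))
InD5⇒Astar∖D1 n s p with astar , rest ← T-∧⁻ (proj₁ (T-∧⁻ {inD5 s} p)) = astar , proj₁ (T-∧⁻ rest)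

InTarget⇒Astar∖D1 : ∀ n t → T (InTarget n t) → T (inAstar t) × T (not (inD1 t))
InTarget⇒Astar∖D1 n t p with astar , rest ← T-∧⁻ {inAstar t} p = astar , proj₁ (T-∧⁻ rest)

h5 : List ℕ → List ℕ
h5 s = mapAt (maxS s) suc s

h5⁻¹ : List ℕ → List ℕ
h5⁻¹ t = mapAt (maxS t) pred t

mapAt-maxS-assemble : ∀ {j y x r} f → maxS (assemble j y x r) ≡ suc j →
                      mapAt (maxS (assemble j y x r)) f (assemble j y x r) ≡ assemble j (f y) x r
mapAt-maxS-assemble {j} {y} {x} {r} f max≡ =
  trans (cong (λ m → mapAt m f (assemble j y x r)) max≡) (mapAt-iota-++ 0 (suc j) f y (x ∷ r))

-- An element (0, 1, …, j, e, x, r) of 𝒟₅ together with its image under h₅.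
record Frame : Set where
  constructor frame
  field
    j e x : ℕ
    r : List ℕ
    x≤1+j : x ≤ suc j
    noMax : maxFrom (3 + j) r ≡ 0
    2+e≤x : 2 + e ≤ x

  source target : List ℕ
  source = assemble j e x r
  target = assemble j (suc e) x r

  1+e≤j : suc e ≤ j
  1+e≤j = ≤-pred (≤-trans 2+e≤x x≤1+j)

  e≤j : e ≤ j
  e≤j = <⇒≤ 1+e≤j

  maxS-source : maxS source ≡ suc j
  maxS-source = maxS-assemble r e≤j x≤1+j noMax

  maxS-target : maxS target ≡ suc j
  maxS-target = maxS-assemble r 1+e≤j x≤1+j noMax

open Frame using (source; target; maxS-source; maxS-target)

InD5≡InTarget : ∀ n F → InD5 n (source F) ≡ InTarget n (target F)
InD5≡InTarget n F@(frame j e x r x≤1+j noMax 2+e≤x) = begin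
  InD5 n s
    ≡⟨ cong (_∧ (length s ≡ᵇ n)) (inD5-assemble (Frame.e≤j F) x≤1+j noMax) ⟩
  (isAscent s ∧ (e + 2 ≤ᵇ x)) ∧ (length s ≡ᵇ n)
    ≡⟨ cong₂ (λ a b → (a ∧ b) ∧ (length s ≡ᵇ n)) ascent≡ (cong (_≤ᵇ x) (+-comm e 2)) ⟩
  (isAscent t ∧ (2 + e ≤ᵇ x)) ∧ (length s ≡ᵇ n)
    ≡⟨ cong (λ l → (isAscent t ∧ (2 + e ≤ᵇ x)) ∧ (l ≡ᵇ n))
            (trans (length-assemble j e x r) (sym (length-assemble j (suc e) x r))) ⟩
  (isAscent t ∧ (2 + e ≤ᵇ x)) ∧ (length t ≡ᵇ n)
    ≡⟨ ∧-shuffle (isAscent t) (2 + e ≤ᵇ x) (length t ≡ᵇ n) ⟩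
  isAscent t ∧ (length t ≡ᵇ n) ∧ (2 + e ≤ᵇ x) ∧ (1 ≤ᵇ suc e)
    ≡⟨ sym (InTarget-assemble (Frame.1+e≤j F) x≤1+j noMax n) ⟩
  InTarget n t ∎
  where
  open ≡-Reasoning
  s = assemble j e x r
  t = assemble j (suc e) x r
  ascent≡ : isAscent s ≡ isAscent t
  ascent≡ = isAscent-assemble x r (Frame.e≤j F) (≤-trans (n≤1+n _) 2+e≤x) (Frame.1+e≤j F) 2+e≤x

D5⇒frame : ∀ n s → T (InD5 n s) → Σ Frame λ F → source F ≡ s
D5⇒frame n s p with uncurry (decompose s) (InD5⇒Astar∖D1 n s p)
... | assembled j e x r e≤j x≤1+j noMax =
  frame j e x r x≤1+j noMax (InD5-assemble⇒ e≤j x≤1+j noMax n p) , refl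

target⇒frame : ∀ n t → T (InTarget n t) → Σ Frame λ F → target F ≡ t
target⇒frame n t q with uncurry (decompose t) (InTarget⇒Astar∖D1 n t q)
... | assembled j zero x r y≤j x≤1+j noMax =
  contradiction (proj₂ (InTarget-assemble⇒ y≤j x≤1+j noMax n q)) λ ()
... | assembled j (suc e) x r 1+e≤j x≤1+j noMax =
  frame j e x r x≤1+j noMax (proj₁ (InTarget-assemble⇒ 1+e≤j x≤1+j noMax n q)) , refl

h5-source : ∀ F → h5 (source F) ≡ target F
h5-source F = mapAt-maxS-assemble suc (maxS-source F)

h5⁻¹-target : ∀ F → h5⁻¹ (target F) ≡ source F
h5⁻¹-target F = mapAt-maxS-assemble pred (maxS-target F)

h5-InTarget : ∀ n s → T (InD5 n s) → T (InTarget n (h5 s))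
h5-InTarget n s p with D5⇒frame n s p
... | F , refl = subst (T ∘ InTarget n) (sym (h5-source F)) (subst T (InD5≡InTarget n F) p)

h5⁻¹-InD5 : ∀ n t → T (InTarget n t) → T (InD5 n (h5⁻¹ t))
h5⁻¹-InD5 n t q with target⇒frame n t q
... | F , refl = subst (T ∘ InD5 n) (sym (h5⁻¹-target F)) (subst T (sym (InD5≡InTarget n F)) q)

h5⁻¹-h5 : ∀ n s → T (InD5 n s) → h5⁻¹ (h5 s) ≡ s
h5⁻¹-h5 n s p with D5⇒frame n s p
... | F , refl = trans (cong h5⁻¹ (h5-source F)) (h5⁻¹-target F)

h5-h5⁻¹ : ∀ n t → T (InTarget n t) → h5 (h5⁻¹ t) ≡ t
h5-h5⁻¹ n t q with target⇒frame n t q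
... | F , refl = trans (cong h5 (h5⁻¹-target F)) (h5-source F)

Σ-T-≡ : ∀ {P : List ℕ → Bool} {s t} {p : T (P s)} {q : T (P t)} → s ≡ t → (s , p) ≡ (t , q)
Σ-T-≡ refl = cong (_ ,_) (T-irrelevant _ _)

h5-bijection : ∀ n → D5n n ⤖ Tgt5n n
h5-bijection n =
  ↔⇒⤖ (mk↔ₛ′ to from (λ (t , q) → Σ-T-≡ (h5-h5⁻¹ n t q)) (λ (s , p) → Σ-T-≡ (h5⁻¹-h5 n s p)))
  where
  to : D5n n → Tgt5n n
  to (s , p) = h5 s , h5-InTarget n s p
  from : Tgt5n n → D5n n
  from (t , q) = h5⁻¹ t , h5⁻¹-InD5 n t q

-- Right-to-left minima and rpos

diag : ℕ → ℕ × ℕ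
diag v = v , v

∸≡suc∸suc : ∀ {k m} → k < m → m ∸ k ≡ suc (m ∸ suc k)
∸≡suc∸suc {zero}  {suc m} _         = refl
∸≡suc∸suc {suc k} {suc m} (s≤s k<m) = ∸≡suc∸suc k<m

rminFrom-iota-++ : ∀ k n l m → m ≤ k + n → (∀ v → allᵇ (v <ᵇ_) l ≡ (v <ᵇ m)) →
                   rminFrom k (iota k n ++ l) ≡ map diag (iota k (m ∸ k)) ++ rminFrom (k + n) l
rminFrom-iota-++ k zero l m m≤k+0 below rewrite +-identityʳ k | m≤n⇒m∸n≡0 m≤k+0 = refl
rminFrom-iota-++ k (suc n) l m m≤k+1+n below
  rewrite allᵇ-++ (k <ᵇ_) (iota (suc k) n) l | allᵇ-<ᵇ-iota (suc k) n (n<1+n k) | below k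
        | rminFrom-iota-++ (suc k) n l m (subst (m ≤_) (+-suc k n) m≤k+1+n) below | +-suc k n
  with k <? m
... | yes k<m rewrite <ᵇ-true k<m | ∸≡suc∸suc k<m = refl
... | no  k≮m
  rewrite <ᵇ-false (≮⇒≥ k≮m) | m≤n⇒m∸n≡0 (≮⇒≥ k≮m)
        | m≤n⇒m∸n≡0 (m≤n⇒m≤1+n (≮⇒≥ k≮m)) = refl

value-head-rminFrom : ∀ k x r → proj₂ (atP (rminFrom k (x ∷ r)) 0) ≡ minList (x ∷ r)
value-head-rminFrom k x []      = refl
value-head-rminFrom k x (y ∷ r)
  rewrite allᵇ-<ᵇ-minList x y r | minList-∷ x y r with x <ᵇ minList (y ∷ r) in x<ᵇm
... | true  = sym (m≤n⇒m⊓n≡m (<⇒≤ (<ᵇ⇒< x _ (subst T (sym x<ᵇm) tt))))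
... | false =
  trans (value-head-rminFrom (suc k) y r) (sym (m≥n⇒m⊓n≡n (≮⇒≥ (λ x<m → subst T x<ᵇm (<⇒<ᵇ x<m)))))

position-rminFrom : ∀ k l i → i < length (rminFrom k l) → k ≤ proj₁ (atP (rminFrom k l) i)
position-rminFrom k (x ∷ l) i i<len with allᵇ (x <ᵇ_) l
position-rminFrom k (x ∷ l) zero    _         | true  = ≤-refl
position-rminFrom k (x ∷ l) (suc i) (s≤s i<ρ) | true  = ≤-trans (n≤1+n k) (position-rminFrom (suc k) l i i<ρ)
position-rminFrom k (x ∷ l) i       i<len     | false = ≤-trans (n≤1+n k) (position-rminFrom (suc k) l i i<len)

length-rminFrom≤ : ∀ k l → length (rminFrom k l) ≤ length l
length-rminFrom≤ k []      = z≤n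
length-rminFrom≤ k (x ∷ l) with allᵇ (x <ᵇ_) l
... | true  = s≤s (length-rminFrom≤ (suc k) l)
... | false = m≤n⇒m≤1+n (length-rminFrom≤ (suc k) l)

1≤length-rminFrom : ∀ k x l → 1 ≤ length (rminFrom k (x ∷ l))
1≤length-rminFrom k x []      = ≤-refl
1≤length-rminFrom k x (y ∷ l) with allᵇ (x <ᵇ_) (y ∷ l)
... | true  = s≤s z≤n
... | false = 1≤length-rminFrom (suc k) y l

lastGood≡lastBelow : ∀ s b → lastGood s b ≡ lastBelow (rposCond s) b
lastGood≡lastBelow s zero    = refl
lastGood≡lastBelow s (suc b) = cong (if rposCond s b then b else_) (lastGood≡lastBelow s b)

-- rposCond with the list of right-to-left minima passed explicitly, so that this list can be
-- replaced by its computed form.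
rposCondFor : List ℕ → List (ℕ × ℕ) → ℕ → Bool
rposCondFor s Z zero    = 2 ≤ᵇ count (_≡ᵇ proj₂ (atP Z 0)) s
rposCondFor s Z (suc i) = 2 ≤ᵇ count (_≡ᵇ proj₂ (atP Z (suc i))) (drop (suc (proj₁ (atP Z i))) s)

rposCond≡rposCondFor : ∀ s i → rposCond s i ≡ rposCondFor s (rminList s) i
rposCond≡rposCondFor s zero    = refl
rposCond≡rposCondFor s (suc i) = refl

rpos≡lastBelow : ∀ s Z → rminList s ≡ Z → length Z ≢ length s →
                 rpos s ≡ lastBelow (rposCondFor s Z) (length Z)
rpos≡lastBelow s Z refl ρ≢n rewrite ≡ᵇ-false ρ≢n =
  trans (lastGood≡lastBelow s (rmin s)) (lastBelow-cong _ _ (rmin s) (λ i _ → rposCond≡rposCondFor s i))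

atP-diag-iota-++ : ∀ k c W i → i < c → atP (map diag (iota k c) ++ W) i ≡ diag (k + i)
atP-diag-iota-++ k (suc c) W zero    _         = cong diag (sym (+-identityʳ k))
atP-diag-iota-++ k (suc c) W (suc i) (s≤s i<c) =
  trans (atP-diag-iota-++ (suc k) c W i i<c) (cong diag (sym (+-suc k i)))

atP-diag-iota-++ʳ : ∀ k c W i → atP (map diag (iota k c) ++ W) (c + i) ≡ atP W i
atP-diag-iota-++ʳ k zero    W i = refl
atP-diag-iota-++ʳ k (suc c) W i = atP-diag-iota-++ʳ (suc k) c W i

length-diag-iota-++ : ∀ c W → length (map diag (iota 0 c) ++ W) ≡ c + length W
length-diag-iota-++ c W =
  trans (length-++ (map diag (iota 0 c))) (cong (_+ length W) (trans (length-map diag (iota 0 c)) (length-iota 0 c)))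

rposCondFor-prefix : ∀ s c W i → i < c →
                     rposCondFor s (map diag (iota 0 c) ++ W) i ≡ (2 ≤ᵇ count (_≡ᵇ i) (drop i s))
rposCondFor-prefix s c W zero    0<c = cong (λ p → 2 ≤ᵇ count (_≡ᵇ proj₂ p) s) (atP-diag-iota-++ 0 c W 0 0<c)
rposCondFor-prefix s c W (suc i) i<c
  rewrite atP-diag-iota-++ 0 c W (suc i) i<c | atP-diag-iota-++ 0 c W i (<⇒≤ i<c) = refl

rposCondFor-middle : ∀ s c W →
                     rposCondFor s (map diag (iota 0 c) ++ W) c ≡ (2 ≤ᵇ count (_≡ᵇ proj₂ (atP W 0)) (drop c s))
rposCondFor-middle s zero    W = refl
rposCondFor-middle s (suc c) W =
  cong₂ (λ p q → 2 ≤ᵇ count (_≡ᵇ proj₂ p) (drop (suc (proj₁ q)) s))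
        (trans (cong (atP Z) (sym (+-identityʳ (suc c)))) (atP-diag-iota-++ʳ 0 (suc c) W 0))
        (atP-diag-iota-++ 0 (suc c) W c ≤-refl)
  where Z = map diag (iota 0 (suc c)) ++ W

rposCondFor-suffix : ∀ s c W i → rposCondFor s (map diag (iota 0 c) ++ W) (c + suc i) ≡ rposCondFor s W (suc i)
rposCondFor-suffix s c W i
  rewrite +-suc c i | sym (+-suc c i) | atP-diag-iota-++ʳ 0 c W (suc i) | atP-diag-iota-++ʳ 0 c W i = refl

module _ {j x : ℕ} {r : List ℕ} where

  rposCondFor-prefix-assemble : ∀ y c W i → i < c → c ≤ suc j →
    rposCondFor (assemble j y x r) (map diag (iota 0 c) ++ W) i ≡ (2 ≤ᵇ suc (chi (y ≡ᵇ i) + count (_≡ᵇ i) (x ∷ r)))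
  rposCondFor-prefix-assemble y c W i i<c c≤1+j =
    trans (rposCondFor-prefix _ c W i i<c) (cong (2 ≤ᵇ_) (count-drop-assemble j y x r (≤-pred (≤-trans i<c c≤1+j))))

  rposCondFor-middle-assemble : ∀ y c W → c ≤ j → proj₂ (atP W 0) ≡ c →
    rposCondFor (assemble j y x r) (map diag (iota 0 c) ++ W) c ≡ (2 ≤ᵇ suc (chi (y ≡ᵇ c) + count (_≡ᵇ c) (x ∷ r)))
  rposCondFor-middle-assemble y c W c≤j head≡c = trans (rposCondFor-middle _ c W)
    (trans (cong (λ v → 2 ≤ᵇ count (_≡ᵇ v) (drop c (assemble j y x r))) head≡c)
           (cong (2 ≤ᵇ_) (count-drop-assemble j y x r c≤j)))

  rposCondFor-tail-assemble : ∀ y y′ W i → suc j ≤ proj₁ (atP W i) →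
    rposCondFor (assemble j y x r) W (suc i) ≡ rposCondFor (assemble j y′ x r) W (suc i)
  rposCondFor-tail-assemble y y′ W i 1+j≤p =
    cong (λ l → 2 ≤ᵇ count (_≡ᵇ proj₂ (atP W (suc i))) l)
         (drop-++-∷ (iota 0 (suc j)) y y′ (x ∷ r) (subst (_≤ proj₁ (atP W i)) (sym (length-iota 0 (suc j))) 1+j≤p))

  rminList-assemble : ∀ y → y ≤ j → rminList (assemble j y x r) ≡
    map diag (iota 0 (y ⊓ minList (x ∷ r))) ++
    (if y <ᵇ minList (x ∷ r) then (suc j , y) ∷ rminFrom (2 + j) (x ∷ r) else rminFrom (2 + j) (x ∷ r))
  rminList-assemble y y≤j
    rewrite rminFrom-iota-++ 0 (suc j) (y ∷ x ∷ r) (y ⊓ minList (x ∷ r)) (≤-trans (m⊓n≤m y _) (m≤n⇒m≤1+n y≤j))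
              (λ v → trans (cong ((v <ᵇ y) ∧_) (allᵇ-<ᵇ-minList v x r)) (sym (<ᵇ-⊓ v y (minList (x ∷ r)))))
          | allᵇ-<ᵇ-minList y x r = refl

  rminList-assemble-≥ : ∀ y → y ≤ j → minList (x ∷ r) ≤ y →
    rminList (assemble j y x r) ≡ map diag (iota 0 (minList (x ∷ r))) ++ rminFrom (2 + j) (x ∷ r)
  rminList-assemble-≥ y y≤j μ≤y rewrite rminList-assemble y y≤j | m≥n⇒m⊓n≡n μ≤y | <ᵇ-false μ≤y = refl

  rminList-assemble-< : ∀ y → y ≤ j → y < minList (x ∷ r) →
    rminList (assemble j y x r) ≡ map diag (iota 0 y) ++ (suc j , y) ∷ rminFrom (2 + j) (x ∷ r)
  rminList-assemble-< y y≤j y<μ rewrite rminList-assemble y y≤j | m≤n⇒m⊓n≡m (<⇒≤ y<μ) | <ᵇ-true y<μ = refl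

  length-assemble≢ : ∀ y c W → c ≤ j → length W ≤ suc (suc (length r)) →
    length (map diag (iota 0 c) ++ W) ≢ length (assemble j y x r)
  length-assemble≢ y c W c≤j |W|≤ eq = <⇒≢ (s≤s (+-mono-≤ c≤j |W|≤))
    (trans (sym (length-diag-iota-++ c W)) (trans eq (length-assemble j y x r)))

-- The statistics of h₅

inD51⇒ : ∀ s → T (inD51 s) → mu s ≤ ealm s ⊎ (mu s ≡ suc (ealm s) × suc (ealm s) ≤ rpos s)
inD51⇒ s h with Equivalence.to T-∨ (proj₂ (T-∧⁻ {inD5 s} h))
... | inj₁ μ≤ᵇe = inj₁ (≤ᵇ⇒≤ _ _ μ≤ᵇe)
... | inj₂ both with μ≡ᵇ , ≤ᵇrpos ← T-∧⁻ both = inj₂ (≡ᵇ⇒≡ _ _ μ≡ᵇ , ≤ᵇ⇒≤ _ _ ≤ᵇrpos)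

inD52⇒ : ∀ s → T (inD52 s) → mu s ≡ suc (ealm s) × rpos s ≡ ealm s
inD52⇒ s h with μ≡ᵇ , rpos≡ᵇ ← T-∧⁻ (proj₂ (T-∧⁻ {inD5 s} h)) =
  ≡ᵇ⇒≡ _ _ μ≡ᵇ , ≡ᵇ⇒≡ _ _ rpos≡ᵇ

inD53⇒ : ∀ s → T (inD53 s) → ealm s + 2 ≤ mu s
inD53⇒ s h = ≤ᵇ⇒≤ _ _ (proj₂ (T-∧⁻ {inD5 s} h))

H5Statistics : List ℕ → List ℕ → Set
H5Statistics s t =
  (asc s ≡ asc t) ×
  (rep s ≡ rep t) ×
  (maxS s ≡ maxS t) ×
  (suc (ealm s) ≡ ealm t) ×
  (zeroS s ≡ zeroS t + chi (ealm s ≡ᵇ 0)) ×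
  (T (inD51 s) → (rmin s ≡ rmin t) × (rpos s ≡ rpos t)) ×
  (T (inD52 s) → (rmin s ≡ rmin t) × (suc (rpos s) ≡ rpos t)) ×
  (T (inD53 s) → (suc (rmin s) ≡ rmin t) × (suc (rpos s) ≡ rpos t))

module FrameStatistics (F : Frame) where
  open Frame F hiding (source; target; maxS-source; maxS-target)

  s = source F
  t = target F

  μ = minList (x ∷ r)
  R = rminFrom (2 + j) (x ∷ r)
  ρ = length R

  ρ≤1+|r| : ρ ≤ suc (length r)
  ρ≤1+|r| = length-rminFrom≤ (2 + j) (x ∷ r)

  1≤ρ : 1 ≤ ρ
  1≤ρ = 1≤length-rminFrom (2 + j) x r

  head-R : proj₂ (atP R 0) ≡ μ
  head-R = value-head-rminFrom (2 + j) x r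

  tail-agrees : ∀ y y′ i → i < ρ → rposCondFor (assemble j y x r) R (suc i) ≡ rposCondFor (assemble j y′ x r) R (suc i)
  tail-agrees y y′ i i<ρ =
    rposCondFor-tail-assemble y y′ R i (≤-trans (n≤1+n _) (position-rminFrom (2 + j) (x ∷ r) i i<ρ))

  ealm-condition : ∀ y W → y ≤ j → proj₂ (atP W 0) ≡ y →
                   rposCondFor (assemble j y x r) (map diag (iota 0 y) ++ W) y ≡ true
  ealm-condition y W y≤j head≡y = trans (rposCondFor-middle-assemble {j} {x} {r} y y W y≤j head≡y)
    (cong (λ b → 2 ≤ᵇ suc (chi b + count (_≡ᵇ y) (x ∷ r))) (≡ᵇ-refl y))

  -- Both have right-to-left minima 0, …, μ − 1 followed by those of (x, r).
  rmin-rpos-≤ : μ ≤ e → rmin s ≡ rmin t × rpos s ≡ rpos t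
  rmin-rpos-≤ μ≤e = cong length (trans Ls (sym Lt)) , (begin
      rpos s                                  ≡⟨ rpos≡lastBelow s Z Ls (length≢ e) ⟩
      lastBelow (rposCondFor s Z) (length Z)  ≡⟨ lastBelow-cong _ _ (length Z) agree ⟩
      lastBelow (rposCondFor t Z) (length Z)  ≡⟨ rpos≡lastBelow t Z Lt (length≢ (suc e)) ⟨
      rpos t                                  ∎)
    where
    open ≡-Reasoning
    Z = map diag (iota 0 μ) ++ R
    Ls = rminList-assemble-≥ e e≤j μ≤e
    Lt = rminList-assemble-≥ (suc e) 1+e≤j (m≤n⇒m≤1+n μ≤e)
    μ≤j = ≤-trans μ≤e e≤j
    length≢ : ∀ y → length Z ≢ length (assemble j y x r)
    length≢ y = length-assemble≢ y μ R μ≤j (m≤n⇒m≤1+n ρ≤1+|r|)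
    minimum-condition : ∀ y → rposCondFor (assemble j y x r) Z μ ≡ true
    minimum-condition y =
      trans (rposCondFor-middle-assemble {j} {x} {r} y μ R μ≤j head-R) (2≤ᵇsuc-+ (chi (y ≡ᵇ μ)) _ (1≤count-minList x r))
    agree : ∀ i → i < length Z → rposCondFor s Z i ≡ rposCondFor t Z i
    agree i i<|Z| with position μ i | subst (i <_) (length-diag-iota-++ μ R) i<|Z|
    ... | before i<μ | _
      rewrite rposCondFor-prefix-assemble {j} {x} {r} e μ R i i<μ (m≤n⇒m≤1+n μ≤j)
            | rposCondFor-prefix-assemble {j} {x} {r} (suc e) μ R i i<μ (m≤n⇒m≤1+n μ≤j)
            | ≡ᵇ-false {e} {i} (>⇒≢ (≤-trans i<μ μ≤e))
            | ≡ᵇ-false {suc e} {i} (>⇒≢ (≤-trans i<μ (m≤n⇒m≤1+n μ≤e))) = refl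
    ... | middle | _ = trans (minimum-condition e) (sym (minimum-condition (suc e)))
    ... | after i′ | i<μ+ρ = begin
      rposCondFor s Z (μ + suc i′)  ≡⟨ rposCondFor-suffix s μ R i′ ⟩
      rposCondFor s R (suc i′)      ≡⟨ tail-agrees e (suc e) i′ (suffix-bound μ i′ ρ i<μ+ρ) ⟩
      rposCondFor t R (suc i′)      ≡⟨ rposCondFor-suffix t μ R i′ ⟨
      rposCondFor t Z (μ + suc i′)  ∎

  Ws = (suc j , e) ∷ R
  Zs = map diag (iota 0 e) ++ Ws
  f = rposCondFor s Zs
  b = e + suc ρ

  source-minima : e < μ → rminList s ≡ Zs × rpos s ≡ lastBelow f b
  source-minima e<μ =
    Ls , trans (rpos≡lastBelow s Zs Ls (length-assemble≢ e e Ws e≤j (s≤s ρ≤1+|r|)))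
               (cong (lastBelow f) (length-diag-iota-++ e Ws))
    where Ls = rminList-assemble-< e e≤j e<μ

  fe : f e ≡ true
  fe = ealm-condition e Ws e≤j refl

  -- The minimum e at index j + 1 of s becomes the run entry e of t; only the conditions at e
  -- and e + 1 can differ.
  rmin-rpos-≡suc : μ ≡ suc e →
                   rmin s ≡ rmin t × ((rpos s ≡ rpos t × suc e ≤ rpos s) ⊎ (rpos s ≡ e × rpos t ≡ suc e))
  rmin-rpos-≡suc μ≡1+e =
    trans (cong length Ls) (trans (length-diag-iota-++ e Ws)
      (trans (+-suc e ρ) (sym (trans (cong length Lt) (length-diag-iota-++ (suc e) R))))) ,
    Sum.map (λ (eq , le) → trans rpos-s (trans eq (sym rpos-t)) , subst (suc e ≤_) (sym rpos-s) le)
            (λ (eq₁ , eq₂) → trans rpos-s eq₁ , trans rpos-t eq₂)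
            (lastBelow-agreeAbove-suc f g e b fe gse 2+e≤b agree)
    where
    open ≡-Reasoning
    e<μ = subst (e <_) (sym μ≡1+e) ≤-refl
    Ls = proj₁ (source-minima e<μ)
    rpos-s = proj₂ (source-minima e<μ)
    Zt = map diag (iota 0 (suc e)) ++ R
    g = rposCondFor t Zt
    Lt : rminList t ≡ Zt
    Lt = subst (λ m → rminList t ≡ map diag (iota 0 m) ++ R) μ≡1+e
               (rminList-assemble-≥ (suc e) 1+e≤j (≤-reflexive μ≡1+e))
    rpos-t : rpos t ≡ lastBelow g b
    rpos-t = trans (rpos≡lastBelow t Zt Lt (length-assemble≢ (suc e) (suc e) R 1+e≤j (m≤n⇒m≤1+n ρ≤1+|r|)))
                   (cong (lastBelow g) (trans (length-diag-iota-++ (suc e) R) (sym (+-suc e ρ))))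
    gse : g (suc e) ≡ true
    gse = ealm-condition (suc e) R 1+e≤j (trans head-R μ≡1+e)
    2+e≤b : 2 + e ≤ b
    2+e≤b = subst (_≤ b) (+-comm e 2) (+-monoʳ-≤ e (s≤s 1≤ρ))
    agree : ∀ i → 2 + e ≤ i → i < b → f i ≡ g i
    agree i 2+e≤i i<b with position e i
    ... | before i<e   = contradiction (≤-trans (n≤1+n e) (≤-trans (n≤1+n _) 2+e≤i)) (<⇒≱ i<e)
    ... | middle       = contradiction (≤-trans (n≤1+n _) 2+e≤i) (<-irrefl refl)
    ... | after zero   = contradiction (≤-pred (subst (2 + e ≤_) (+1≡suc e) 2+e≤i)) (<-irrefl refl)
    ... | after (suc i″) = begin
      f (e + suc (suc i″))      ≡⟨ rposCondFor-suffix s e Ws (suc i″) ⟩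
      rposCondFor s R (suc i″)  ≡⟨ tail-agrees e (suc e) i″ (≤-pred (suffix-bound e (suc i″) (suc ρ) i<b)) ⟩
      rposCondFor t R (suc i″)  ≡⟨ rposCondFor-suffix t (suc e) R i″ ⟨
      g (suc e + suc i″)        ≡⟨ cong g (+-suc e (suc i″)) ⟨
      g (e + suc (suc i″))      ∎

  -- t has the additional minimum e from its run, and its conditions are those of s shifted by one.
  rmin-rpos-≥ : 2 + e ≤ μ → suc (rmin s) ≡ rmin t × suc (rpos s) ≡ rpos t
  rmin-rpos-≥ 2+e≤μ =
    trans (cong (suc ∘ length) Ls) (trans (cong suc (length-diag-iota-++ e Ws))
      (sym (trans (cong length Lt) (length-diag-iota-++ (suc e) Wt)))) ,
    (begin
      suc (rpos s)              ≡⟨ cong suc rpos-s ⟩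
      suc (lastBelow f b)       ≡⟨ lastBelow-shift f g b shift (m<m+n e z<s) fe ⟨
      lastBelow g (suc b)       ≡⟨ cong (lastBelow g) (length-diag-iota-++ (suc e) Wt) ⟨
      lastBelow g (length Zt)   ≡⟨ rpos≡lastBelow t Zt Lt |Zt|≢ ⟨
      rpos t                    ∎)
    where
    open ≡-Reasoning
    Ls = proj₁ (source-minima (≤-trans (n≤1+n _) 2+e≤μ))
    rpos-s = proj₂ (source-minima (≤-trans (n≤1+n _) 2+e≤μ))
    Wt = (suc j , suc e) ∷ R
    Zt = map diag (iota 0 (suc e)) ++ Wt
    g = rposCondFor t Zt
    Lt : rminList t ≡ Zt
    Lt = rminList-assemble-< (suc e) 1+e≤j 2+e≤μ
    |Zt|≢ = length-assemble≢ (suc e) (suc e) Wt 1+e≤j (s≤s ρ≤1+|r|)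
    shift : ∀ i → i < b → g (suc i) ≡ f i
    shift i i<b with position e i
    ... | before i<e
      rewrite rposCondFor-prefix-assemble {j} {x} {r} (suc e) (suc e) Wt (suc i) (s<s i<e) (m≤n⇒m≤1+n 1+e≤j)
            | rposCondFor-prefix-assemble {j} {x} {r} e e Ws i i<e (m≤n⇒m≤1+n e≤j)
            | count-<minList {suc i} x r (≤-trans (s<s i<e) (≤-trans (n≤1+n _) 2+e≤μ))
            | count-<minList {i} x r (<-trans i<e (≤-trans (n≤1+n _) 2+e≤μ)) = refl
    ... | middle = trans (ealm-condition (suc e) Wt 1+e≤j refl) (sym fe)
    ... | after zero = begin
      g (suc e + 1)            ≡⟨ rposCondFor-suffix t (suc e) Wt 0 ⟩
      rposCondFor t Wt 1       ≡⟨ rposCondFor-tail-assemble (suc e) e Wt 0 ≤-refl ⟩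
      rposCondFor s Ws 1       ≡⟨ rposCondFor-suffix s e Ws 0 ⟨
      f (e + 1)                ∎
    ... | after (suc i″) = begin
      g (suc e + suc (suc i″))  ≡⟨ rposCondFor-suffix t (suc e) Wt (suc i″) ⟩
      rposCondFor t R (suc i″)  ≡⟨ tail-agrees (suc e) e i″ (≤-pred (suffix-bound e (suc i″) (suc ρ) i<b)) ⟩
      rposCondFor s R (suc i″)  ≡⟨ rposCondFor-suffix s e Ws (suc i″) ⟨
      f (e + suc (suc i″))      ∎

  ealm-s : ealm s ≡ e
  ealm-s = ealm-assemble (maxS-source F)

  mu-s : mu s ≡ μ
  mu-s = mu-assemble (maxS-source F)

  zeroS-shift : zeroS s ≡ zeroS t + chi (ealm s ≡ᵇ 0)
  zeroS-shift = begin
    zeroS s                         ≡⟨ zeroS-assemble j e x r ⟩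
    zeroS run + (c + zeroS (x ∷ r)) ≡⟨ cong (zeroS run +_) (+-comm c (zeroS (x ∷ r))) ⟩
    zeroS run + (zeroS (x ∷ r) + c) ≡⟨ +-assoc (zeroS run) (zeroS (x ∷ r)) c ⟨
    zeroS run + zeroS (x ∷ r) + c   ≡⟨ cong₂ _+_ (zeroS-assemble j (suc e) x r) (cong (chi ∘ (_≡ᵇ 0)) ealm-s) ⟨
    zeroS t + chi (ealm s ≡ᵇ 0)     ∎
    where
    open ≡-Reasoning
    run = iota 0 (suc j)
    c = chi (e ≡ᵇ 0)

  rmin-rpos-D51 : T (inD51 s) → (rmin s ≡ rmin t) × (rpos s ≡ rpos t)
  rmin-rpos-D51 h with inD51⇒ s h
  ... | inj₁ μ≤e = rmin-rpos-≤ (subst₂ _≤_ mu-s ealm-s μ≤e)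
  ... | inj₂ (μ≡ , 1+e≤rpos) with rmin-rpos-≡suc (trans (sym mu-s) (trans μ≡ (cong suc ealm-s)))
  ...   | rmin≡ , inj₁ (rpos≡ , _) = rmin≡ , rpos≡
  ...   | _ , inj₂ (rpos≡e , _) =
    contradiction (subst₂ (λ a b → suc a ≤ b) ealm-s rpos≡e 1+e≤rpos) (<-irrefl refl)

  rmin-rpos-D52 : T (inD52 s) → (rmin s ≡ rmin t) × (suc (rpos s) ≡ rpos t)
  rmin-rpos-D52 h with μ≡ , rpos≡ealm ← inD52⇒ s h
    with rmin-rpos-≡suc (trans (sym mu-s) (trans μ≡ (cong suc ealm-s)))
  ... | _ , inj₁ (_ , 1+e≤rpos) =
    contradiction (subst (suc e ≤_) (trans rpos≡ealm ealm-s) 1+e≤rpos) (<-irrefl refl)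
  ... | rmin≡ , inj₂ (rpos≡e , rpos-t≡) = rmin≡ , trans (cong suc rpos≡e) (sym rpos-t≡)

  rmin-rpos-D53 : T (inD53 s) → (suc (rmin s) ≡ rmin t) × (suc (rpos s) ≡ rpos t)
  rmin-rpos-D53 h = rmin-rpos-≥ (subst₂ _≤_ (trans (cong (_+ 2) ealm-s) (+-comm e 2)) mu-s (inD53⇒ s h))

  frame-statistics : H5Statistics s t
  frame-statistics =
    trans (asc-assemble x r e≤j (≤-trans (n≤1+n _) 2+e≤x)) (sym (asc-assemble x r 1+e≤j 2+e≤x)) ,
    rep-assemble x r e≤j 1+e≤j ,
    trans (maxS-source F) (sym (maxS-target F)) ,
    trans (cong suc ealm-s) (sym (ealm-assemble (maxS-target F))) ,
    zeroS-shift ,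
    rmin-rpos-D51 , rmin-rpos-D52 , rmin-rpos-D53

open FrameStatistics using (frame-statistics)

h5-statistics : ∀ n s → T (InD5 n s) → H5Statistics s (h5 s)
h5-statistics n s p with D5⇒frame n s p
... | F , refl = subst (H5Statistics (source F)) (sym (h5-source F)) (frame-statistics F)

lemma30 : (n : ℕ) → Σ (D5n n ⤖ Tgt5n n) λ h → (x : D5n n) →
    (asc (proj₁ x) ≡ asc (proj₁ (Bijection.to h x))) ×
    (rep (proj₁ x) ≡ rep (proj₁ (Bijection.to h x))) ×
    (maxS (proj₁ x) ≡ maxS (proj₁ (Bijection.to h x))) ×
    (suc (ealm (proj₁ x)) ≡ ealm (proj₁ (Bijection.to h x))) ×
    (zeroS (proj₁ x) ≡ zeroS (proj₁ (Bijection.to h x)) + chi (ealm (proj₁ x) ≡ᵇ 0)) ×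
    (T (inD51 (proj₁ x)) →
      (rmin (proj₁ x) ≡ rmin (proj₁ (Bijection.to h x))) ×
      (rpos (proj₁ x) ≡ rpos (proj₁ (Bijection.to h x)))) ×
    (T (inD52 (proj₁ x)) →
      (rmin (proj₁ x) ≡ rmin (proj₁ (Bijection.to h x))) ×
      (suc (rpos (proj₁ x)) ≡ rpos (proj₁ (Bijection.to h x)))) ×
    (T (inD53 (proj₁ x)) →
      (suc (rmin (proj₁ x)) ≡ rmin (proj₁ (Bijection.to h x))) ×
      (suc (rpos (proj₁ x)) ≡ rpos (proj₁ (Bijection.to h x))))
lemma30 n = h5-bijection n , λ (s , p) → h5-statistics n s p
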